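{- We have \[ 2\overline{J}_{1,6}\overline{J}_{1,3}+2\overline{J}_{3,6}\overline{J}_{3,12}=\overline{J}_{0,1}\overline{J}_{0,2}. \]
   Context: Let $q=e^{2\pi i\tau}$ with $\operatorname{Im}\tau>0$. For $x\neq 0$ let $j(x;q)=\prod_{i\ge0}(1-q^ix)(1-q^{i+1}/x)(1-q^{i+1})=\sum_{n\in\mathbb{Z}}(-1)^nq^{\binom n2}x^n$. For integers $a$ and $k>0$: $\overline{J}_{a,k}=j(-q^a;q^k)$. -}

module Defs where

open import Data.Nat as ℕ using (ℕ; zero; suc; _∸_)
open import Data.Integer as ℤ using (ℤ; +_)
open import Data.List using (List; map; upTo; foldr)
open import Relation.Nullary.Decidable using (does)
open import Data.Bool using (if_then_else_)

-- Formal power series in q with integer coefficients (coefficient of q^N).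
FPS : Set
FPS = ℕ → ℤ

ℤsum : List ℤ → ℤ
ℤsum = foldr ℤ._+_ (+ 0)

_⊛_ : FPS → FPS → FPS
(f ⊛ g) N = ℤsum (map (λ i → f i ℤ.* g (N ∸ i)) (upTo (suc N)))

-- Exponent of the n-th term of j(-q^a; q^k) = Σ_n (-1)^n q^{k·C(n,2)} (-q^a)^n
--   = Σ_n q^{k·C(n,2) + a·n};  we use twice the exponent: k n (n-1) + 2 a n.
twiceExp : ℕ → ℕ → ℤ → ℤ
twiceExp a k n = (+ k) ℤ.* n ℤ.* (n ℤ.- + 1) ℤ.+ (+ 2) ℤ.* (+ a) ℤ.* n

-- Coefficient of q^N in Jbar_{a,k} = j(-q^a; q^k) = Σ_{n∈ℤ} q^{k·C(n,2)+a·n},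
-- i.e. the number of integers n with k·C(n,2) + a·n = N.
-- For 0 ≤ a ≤ k (all uses below) every such n satisfies |n| ≤ N+1,
-- so the sum over n ∈ [-(N+1), N+1] is the full sum over ℤ.
Jbar : ℕ → ℕ → FPS
Jbar a k N =
  ℤsum (map (λ i → let n = (+ i) ℤ.- (+ suc N) in
                    if does (twiceExp a k n ℤ.≟ (+ 2) ℤ.* (+ N)) then + 1 else + 0)
            (upTo (suc (suc (2 ℕ.* suc N)))))

{-# OPTIONS --safe #-}
module Submission where

-- The coefficient of q^N in J̄_{a,k} J̄_{a′,k′} counts the lattice points (n, m) ∈ ℤ² with
-- k C(n,2) + a n + k′ C(m,2) + a′ m = N.  With Q₀, Q₁, Q₂ twice these exponents for
-- J̄_{0,1} J̄_{0,2}, J̄_{1,6} J̄_{1,3} and J̄_{3,6} J̄_{3,12}, one checks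
--   Q₀(2t − a, 1 − t − a) = Q₀(1 + a − 2t, a + t) = Q₁(t, a),
--   Q₀(2t + 2r, 2r − t) = Q₀(2t − 2r + 1, 1 − 2r − t) = Q₂(t, r),
-- and these four maps are bijections of ℤ² onto the classes n − m ≡ 2 and n − m ≡ 1 (mod 3)
-- and onto the two halves of the class n ≡ m (mod 3) told apart by the parity of m + (n − m)/3.
-- So each level set of Q₀ is in bijection with two copies of that of Q₁ and two of that of Q₂.
-- Every such map is a composite of shears (n, m) ↦ (n + c(m), m), sign changes, the swap and
-- restriction to a residue class, which all preserve sums of finitely supported functions on
-- ℤ²; so Σ φ(Q₀) = 2 Σ φ(Q₁) + 2 Σ φ(Q₂) for every weight φ, and φ = [· = 2N] gives the theorem.

open import Defs
open import Data.Nat as ℕ using (ℕ; zero; suc; z≤n; s≤s)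
import Data.Nat.Properties as ℕ
import Data.Nat.Tactic.RingSolver as ℕ-Solver
open import Data.Integer as ℤ using (ℤ; +_; -[1+_]; _+_; _*_; -_; _-_; ∣_∣)
import Data.Integer.Properties as ℤ
open import Data.Integer.Tactic.RingSolver using (solve-∀; ring)
open import Tactic.RingSolver.NonReflective ring using (solve; _⊜_)
open import Tactic.RingSolver.Core.Expression using (Expr; Κ; _⊕_; _⊗_; ⊝_)
open import Algebra.Properties.CommutativeSemigroup ℤ.+-commutativeSemigroup using (xy∙z≈xz∙y)
open import Data.Product using (_×_; _,_; proj₁; proj₂)
open import Function using (_∘_)
open import Relation.Nullary using (Dec; yes; no; does; ¬_)
open import Relation.Nullary.Decidable using (does-⇔; dec-false)
open import Function.Bundles using (_⇔_; mk⇔)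
open import Data.Bool using (if_then_else_)
open import Data.List using (map; applyUpTo)
open import Data.Nat.Combinatorics using (_C_; nC1≡n; nCk+nC[k+1]≡[n+1]C[k+1])
open import Relation.Binary.PropositionalEquality

∑< : ℕ → (ℕ → ℤ) → ℤ
∑< zero    h = + 0
∑< (suc L) h = h 0 + ∑< L (h ∘ suc)

∑<-cong : ∀ L {h h′ : ℕ → ℤ} → (∀ i → i ℕ.< L → h i ≡ h′ i) → ∑< L h ≡ ∑< L h′
∑<-cong zero    eq = refl
∑<-cong (suc L) eq = cong₂ _+_ (eq 0 (s≤s z≤n)) (∑<-cong L (λ i i<L → eq (suc i) (s≤s i<L)))

∑<-zero : ∀ L {h : ℕ → ℤ} → (∀ i → i ℕ.< L → h i ≡ + 0) → ∑< L h ≡ + 0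
∑<-zero zero    eq = refl
∑<-zero (suc L) eq = cong₂ _+_ (eq 0 (s≤s z≤n)) (∑<-zero L (λ i i<L → eq (suc i) (s≤s i<L)))

∑<-++ : ∀ L M (h : ℕ → ℤ) → ∑< (L ℕ.+ M) h ≡ ∑< L h + ∑< M (λ i → h (L ℕ.+ i))
∑<-++ zero    M h = sym (ℤ.+-identityˡ _)
∑<-++ (suc L) M h = trans (cong (_+_ (h 0)) (∑<-++ L M (h ∘ suc))) (sym (ℤ.+-assoc (h 0) _ _))

∑<-blocks : ∀ L k (h : ℕ → ℤ) → ∑< (L ℕ.* k) h ≡ ∑< L (λ i → ∑< k (λ r → h (i ℕ.* k ℕ.+ r)))
∑<-blocks zero    k h = refl
∑<-blocks (suc L) k h = trans (∑<-++ k (L ℕ.* k) h)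
  (cong (_+_ (∑< k h)) (trans (∑<-blocks L k (λ j → h (k ℕ.+ j)))
    (∑<-cong L (λ i _ → ∑<-cong k (λ r _ → cong h (sym (ℕ.+-assoc k (i ℕ.* k) r)))))))

-- Sums of finitely supported functions on ℤ

∑ℤ : ℕ → (ℤ → ℤ) → ℤ
∑ℤ zero    f = f (+ 0)
∑ℤ (suc W) f = ∑ℤ W f + f (+ suc W) + f -[1+ W ]

∑ℤ-cong : ∀ W {f g : ℤ → ℤ} → (∀ n → f n ≡ g n) → ∑ℤ W f ≡ ∑ℤ W g
∑ℤ-cong zero    eq = eq (+ 0)
∑ℤ-cong (suc W) eq = cong₂ _+_ (cong₂ _+_ (∑ℤ-cong W eq) (eq _)) (eq _)

∑ℤ-zero : ∀ W {f : ℤ → ℤ} → (∀ n → f n ≡ + 0) → ∑ℤ W f ≡ + 0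
∑ℤ-zero zero    eq = eq (+ 0)
∑ℤ-zero (suc W) eq = cong₂ _+_ (cong₂ _+_ (∑ℤ-zero W eq) (eq _)) (eq _)

∑ℤ-distrib-+ : ∀ W (f g : ℤ → ℤ) → ∑ℤ W (λ n → f n + g n) ≡ ∑ℤ W f + ∑ℤ W g
∑ℤ-distrib-+ zero    f g = refl
∑ℤ-distrib-+ (suc W) f g = trans (cong (λ x → x + (f _ + g _) + (f _ + g _)) (∑ℤ-distrib-+ W f g))
  (interchange (∑ℤ W f) (∑ℤ W g) (f _) (g _) (f _) (g _))
  where
  interchange : ∀ a b c d e h → a + b + (c + d) + (e + h) ≡ a + c + e + (b + d + h)
  interchange = solve-∀

∑ℤ-*ˡ : ∀ W c (f : ℤ → ℤ) → ∑ℤ W (λ n → c * f n) ≡ c * ∑ℤ W f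
∑ℤ-*ˡ zero    c f = refl
∑ℤ-*ˡ (suc W) c f = trans (cong (λ x → x + c * f _ + c * f _) (∑ℤ-*ˡ W c f)) (distrib c _ _ _)
  where
  distrib : ∀ c x y z → c * x + c * y + c * z ≡ c * (x + y + z)
  distrib = solve-∀

∑ℤ-*ʳ : ∀ W c (f : ℤ → ℤ) → ∑ℤ W (λ n → f n * c) ≡ ∑ℤ W f * c
∑ℤ-*ʳ W c f = trans (∑ℤ-cong W (λ n → ℤ.*-comm (f n) c))
  (trans (∑ℤ-*ˡ W c f) (ℤ.*-comm c (∑ℤ W f)))

∑ℤ-comm : ∀ A B (h : ℤ → ℤ → ℤ) →
  ∑ℤ A (λ m → ∑ℤ B (λ n → h n m)) ≡ ∑ℤ B (λ n → ∑ℤ A (λ m → h n m))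
∑ℤ-comm zero    B h = refl
∑ℤ-comm (suc A) B h = begin
  ∑ℤ A (λ m → ∑ℤ B (λ n → h n m)) + ∑ℤ B (λ n → h n (+ suc A)) + ∑ℤ B (λ n → h n -[1+ A ])
    ≡⟨ cong (λ x → x + ∑ℤ B (λ n → h n (+ suc A)) + ∑ℤ B (λ n → h n -[1+ A ])) (∑ℤ-comm A B h) ⟩
  ∑ℤ B (λ n → ∑ℤ A (h n)) + ∑ℤ B (λ n → h n (+ suc A)) + ∑ℤ B (λ n → h n -[1+ A ])
    ≡⟨ cong (_+ ∑ℤ B (λ n → h n -[1+ A ])) (sym (∑ℤ-distrib-+ B _ _)) ⟩
  ∑ℤ B (λ n → ∑ℤ A (h n) + h n (+ suc A)) + ∑ℤ B (λ n → h n -[1+ A ])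
    ≡⟨ sym (∑ℤ-distrib-+ B _ _) ⟩
  ∑ℤ B (λ n → ∑ℤ (suc A) (h n)) ∎
  where open ≡-Reasoning

∑ℤ-neg : ∀ W (f : ℤ → ℤ) → ∑ℤ W (f ∘ -_) ≡ ∑ℤ W f
∑ℤ-neg zero    f = refl
∑ℤ-neg (suc W) f = trans (cong (λ x → x + f -[1+ W ] + f (+ suc W)) (∑ℤ-neg W f))
  (xy∙z≈xz∙y (∑ℤ W f) _ _)

∑<-∑ℤ : ∀ L W (h : ℕ → ℤ → ℤ) → ∑< L (λ i → ∑ℤ W (h i)) ≡ ∑ℤ W (λ n → ∑< L (λ i → h i n))
∑<-∑ℤ zero    W h = sym (∑ℤ-zero W (λ _ → refl))
∑<-∑ℤ (suc L) W h = trans (cong (_+_ (∑ℤ W (h 0))) (∑<-∑ℤ L W (h ∘ suc)))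
  (sym (∑ℤ-distrib-+ W (h 0) _))

∑ℤ-asRange : ∀ W (f : ℤ → ℤ) → ∑ℤ W f ≡ ∑< (suc (W ℕ.+ W)) (λ j → f (+ j - + W))
∑ℤ-asRange zero    f = sym (ℤ.+-identityʳ (f (+ 0)))
∑ℤ-asRange (suc W) f = sym (begin
  f (+ 0 - + suc W) + ∑< (suc W ℕ.+ suc W) (λ j → f (+ suc j - + suc W))
    ≡⟨ cong₂ _+_ (cong f (zero-minus (+ suc W))) (cong (λ L → ∑< L (λ j → f (+ suc j - + suc W))) length) ⟩
  f -[1+ W ] + ∑< (suc (W ℕ.+ W) ℕ.+ 1) (λ j → f (+ suc j - + suc W))
    ≡⟨ cong (_+_ (f -[1+ W ])) (∑<-++ (suc (W ℕ.+ W)) 1 (λ j → f (+ suc j - + suc W))) ⟩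
  f -[1+ W ] + (∑< (suc (W ℕ.+ W)) (λ j → f (+ suc j - + suc W)) + (f (+ suc (suc (W ℕ.+ W) ℕ.+ 0) - + suc W) + + 0))
    ≡⟨ cong₂ (λ x y → f -[1+ W ] + (x + (f y + + 0)))
         (trans (∑<-cong (suc (W ℕ.+ W)) (λ j _ → cong f (suc-minus-suc (+ j) (+ W)))) (sym (∑ℤ-asRange W f)))
         (top (+ W)) ⟩
  f -[1+ W ] + (∑ℤ W f + (f (+ suc W) + + 0))
    ≡⟨ rearrange (f -[1+ W ]) (∑ℤ W f) (f (+ suc W)) ⟩
  ∑ℤ W f + f (+ suc W) + f -[1+ W ] ∎)
  where
  open ≡-Reasoning
  length : suc W ℕ.+ suc W ≡ suc (W ℕ.+ W) ℕ.+ 1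
  length = trans (ℕ.+-suc (suc W) W) (ℕ.+-comm 1 _)
  zero-minus : ∀ x → + 0 - x ≡ - x
  zero-minus = solve-∀
  suc-minus-suc : ∀ x y → (+ 1 + x) - (+ 1 + y) ≡ x - y
  suc-minus-suc = solve-∀
  top : ∀ x → (+ 1 + (+ 1 + (x + x)) + + 0) - (+ 1 + x) ≡ + 1 + x
  top = solve-∀
  rearrange : ∀ a b c → a + (b + (c + + 0)) ≡ b + c + a
  rearrange = solve-∀

VanishesBeyond : ℕ → (ℤ → ℤ) → Set
VanishesBeyond W f = ∀ n → W ℕ.< ∣ n ∣ → f n ≡ + 0

VanishesBeyond-mono : ∀ {W W′ f} → W ℕ.≤ W′ → VanishesBeyond W f → VanishesBeyond W′ f
VanishesBeyond-mono W≤W′ vanish n W′<∣n∣ = vanish n (ℕ.≤-<-trans W≤W′ W′<∣n∣)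

-- The range is [-(p + W), W + q].
∑<-around-∑ℤ : ∀ {W f} → VanishesBeyond W f → ∀ p q →
  ∑< (p ℕ.+ suc (W ℕ.+ W) ℕ.+ q) (λ j → f (+ j - + (p ℕ.+ W))) ≡ ∑ℤ W f
∑<-around-∑ℤ {W} {f} vanish p q = begin
  ∑< (p ℕ.+ M ℕ.+ q) g
    ≡⟨ ∑<-++ (p ℕ.+ M) q g ⟩
  ∑< (p ℕ.+ M) g + ∑< q (λ j → g (p ℕ.+ M ℕ.+ j))
    ≡⟨ cong₂ _+_ (∑<-++ p M g) (∑<-zero q λ j _ → vanish _ (W<∣above∣ j)) ⟩
  ∑< p g + ∑< M (λ i → g (p ℕ.+ i)) + + 0
    ≡⟨ ℤ.+-identityʳ _ ⟩
  ∑< p g + ∑< M (λ i → g (p ℕ.+ i))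
    ≡⟨ cong₂ _+_ (∑<-zero p below) (∑<-cong M (λ i _ → cong f (shift (+ p) (+ i) (+ W)))) ⟩
  + 0 + ∑< M (λ i → f (+ i - + W))
    ≡⟨ trans (ℤ.+-identityˡ _) (sym (∑ℤ-asRange W f)) ⟩
  ∑ℤ W f ∎
  where
  open ≡-Reasoning
  M = suc (W ℕ.+ W)
  g = λ j → f (+ j - + (p ℕ.+ W))
  shift : ∀ x i w → (x + i) - (x + w) ≡ i - w
  shift = solve-∀
  above : ∀ x w j → (x + (+ 1 + (w + w)) + j) - (x + w) ≡ + 1 + (w + j)
  above = solve-∀
  below-offset : ∀ x d w → x - (+ 1 + x + d + w) ≡ - (+ 1 + (d + w))
  below-offset = solve-∀
  W<∣above∣ : ∀ j → W ℕ.< ∣ + (p ℕ.+ M ℕ.+ j) - + (p ℕ.+ W) ∣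
  W<∣above∣ j = subst (λ z → W ℕ.< ∣ z ∣) (sym (above (+ p) (+ W) (+ j))) (s≤s (ℕ.m≤m+n W j))
  below : ∀ j → j ℕ.< p → g j ≡ + 0
  below j j<p = vanish _ (subst (λ z → W ℕ.< ∣ z ∣) (sym index) (s≤s (ℕ.m≤n+m W d)))
    where
    d = p ℕ.∸ suc j
    index : + j - + (p ℕ.+ W) ≡ - (+ 1 + (+ d + + W))
    index = trans (cong (λ p′ → + j - + (p′ ℕ.+ W)) (sym (ℕ.m+[n∸m]≡n j<p))) (below-offset (+ j) (+ d) (+ W))

∑ℤ-grow : ∀ {W f} → VanishesBeyond W f → ∀ {W′} → W ℕ.≤ W′ → ∑ℤ W′ f ≡ ∑ℤ W f
∑ℤ-grow {W} {f} vanish {W′} W≤W′ = begin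
  ∑ℤ W′ f
    ≡⟨ ∑ℤ-asRange W′ f ⟩
  ∑< (suc (W′ ℕ.+ W′)) (λ j → f (+ j - + W′))
    ≡⟨ cong₂ (λ L w → ∑< L (λ j → f (+ j - + w))) length offset ⟩
  ∑< (d ℕ.+ suc (W ℕ.+ W) ℕ.+ d) (λ j → f (+ j - + (d ℕ.+ W)))
    ≡⟨ ∑<-around-∑ℤ vanish d d ⟩
  ∑ℤ W f ∎
  where
  open ≡-Reasoning
  d = W′ ℕ.∸ W
  offset : W′ ≡ d ℕ.+ W
  offset = sym (ℕ.m∸n+n≡m W≤W′)
  length : suc (W′ ℕ.+ W′) ≡ d ℕ.+ suc (W ℕ.+ W) ℕ.+ d
  length = trans (cong (λ w → suc (w ℕ.+ w)) offset) (lemma d W)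
    where
    lemma : ∀ d w → suc (d ℕ.+ w ℕ.+ (d ℕ.+ w)) ≡ d ℕ.+ suc (w ℕ.+ w) ℕ.+ d
    lemma = ℕ-Solver.solve-∀

HasSum : ℕ → (ℤ → ℤ) → ℤ → Set
HasSum W f s = VanishesBeyond W f × ∑ℤ W f ≡ s

HasSum-mono : ∀ {W W′ f s} → W ℕ.≤ W′ → HasSum W f s → HasSum W′ f s
HasSum-mono W≤W′ (vanish , sum) = VanishesBeyond-mono W≤W′ vanish , trans (∑ℤ-grow vanish W≤W′) sum

HasSum-neg : ∀ {W f s} → HasSum W f s → HasSum W (f ∘ -_) s
HasSum-neg {W} {f} (vanish , sum) =
  (λ n lt → vanish (- n) (subst (W ℕ.<_) (sym (ℤ.∣-i∣≡∣i∣ n)) lt)) , trans (∑ℤ-neg W f) sum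

HasSum-shift : ∀ {W f s} c → HasSum W f s → HasSum (∣ c ∣ ℕ.+ W) (λ n → f (n + c)) s
HasSum-shift {W} {f} c (vanish , sum) = vanish-shifted , trans (∑ℤ-shift c) sum
  where
  vanish-shifted : VanishesBeyond (∣ c ∣ ℕ.+ W) (λ n → f (n + c))
  vanish-shifted n lt = vanish (n + c) (ℕ.+-cancelˡ-< ∣ c ∣ W (∣ n + c ∣) (ℕ.<-≤-trans lt ∣n∣≤))
    where
    ∣n∣≤ : ∣ n ∣ ℕ.≤ ∣ c ∣ ℕ.+ ∣ n + c ∣
    ∣n∣≤ = begin
      ∣ n ∣                   ≡⟨ cong ∣_∣ (sym (cancel n c)) ⟩
      ∣ n + c + - c ∣         ≤⟨ ℤ.∣i+j∣≤∣i∣+∣j∣ (n + c) (- c) ⟩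
      ∣ n + c ∣ ℕ.+ ∣ - c ∣   ≡⟨ cong (∣ n + c ∣ ℕ.+_) (ℤ.∣-i∣≡∣i∣ c) ⟩
      ∣ n + c ∣ ℕ.+ ∣ c ∣     ≡⟨ ℕ.+-comm _ ∣ c ∣ ⟩
      ∣ c ∣ ℕ.+ ∣ n + c ∣     ∎
      where
      open ℕ.≤-Reasoning
      cancel : ∀ x y → x + y + - y ≡ x
      cancel = solve-∀
  via-around : ∀ W′ p q c → suc (W′ ℕ.+ W′) ≡ p ℕ.+ suc (W ℕ.+ W) ℕ.+ q →
    (∀ j → + j - + W′ + c ≡ + j - + (p ℕ.+ W)) → ∑ℤ W′ (λ n → f (n + c)) ≡ ∑ℤ W f
  via-around W′ p q c length index = begin
    ∑ℤ W′ (λ n → f (n + c))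
      ≡⟨ ∑ℤ-asRange W′ _ ⟩
    ∑< (suc (W′ ℕ.+ W′)) (λ j → f (+ j - + W′ + c))
      ≡⟨ cong (λ L → ∑< L (λ j → f (+ j - + W′ + c))) length ⟩
    ∑< (p ℕ.+ suc (W ℕ.+ W) ℕ.+ q) (λ j → f (+ j - + W′ + c))
      ≡⟨ ∑<-cong (p ℕ.+ suc (W ℕ.+ W) ℕ.+ q) (λ j _ → cong f (index j)) ⟩
    ∑< (p ℕ.+ suc (W ℕ.+ W) ℕ.+ q) (λ j → f (+ j - + (p ℕ.+ W)))
      ≡⟨ ∑<-around-∑ℤ vanish p q ⟩
    ∑ℤ W f ∎
    where open ≡-Reasoning
  ∑ℤ-shift : ∀ c → ∑ℤ (∣ c ∣ ℕ.+ W) (λ n → f (n + c)) ≡ ∑ℤ W f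
  ∑ℤ-shift (+ k) = via-around (k ℕ.+ W) 0 (k ℕ.+ k) (+ k) (length k W) (λ j → index (+ j) (+ k) (+ W))
    where
    length : ∀ k w → suc (k ℕ.+ w ℕ.+ (k ℕ.+ w)) ≡ suc (w ℕ.+ w) ℕ.+ (k ℕ.+ k)
    length = ℕ-Solver.solve-∀
    index : ∀ j k w → j - (k + w) + k ≡ j - w
    index = solve-∀
  ∑ℤ-shift -[1+ k ] = via-around (suc k ℕ.+ W) (suc k ℕ.+ suc k) 0 -[1+ k ] (length k W)
    (λ j → index (+ j) (+ k) (+ W))
    where
    length : ∀ k w → suc (suc k ℕ.+ w ℕ.+ (suc k ℕ.+ w)) ≡ suc k ℕ.+ suc k ℕ.+ suc (w ℕ.+ w) ℕ.+ 0
    length = ℕ-Solver.solve-∀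
    index : ∀ j k w → j - (+ 1 + k + w) + - (+ 1 + k) ≡ j - (+ 1 + k + (+ 1 + k) + w)
    index = solve-∀

∣t∣≤∣kt+r∣ : ∀ {k r} t → r ℕ.< k → 0 ℕ.< ∣ t ∣ → ∣ t ∣ ℕ.≤ ∣ + k * t + + r ∣
∣t∣≤∣kt+r∣ {suc k} {r} t r<k 0<∣t∣ = ℕ.+-cancelʳ-≤ r ∣ t ∣ ∣ kt+r ∣ (begin
  ∣ t ∣ ℕ.+ r               ≤⟨ ℕ.+-monoʳ-≤ ∣ t ∣ (ℕ.≤-trans (ℕ.s≤s⁻¹ r<k) k≤k∣t∣) ⟩
  suc k ℕ.* ∣ t ∣           ≡⟨ sym (ℤ.abs-* (+ suc k) t) ⟩
  ∣ + suc k * t ∣           ≡⟨ cong ∣_∣ (sym (cancel (+ suc k * t) (+ r))) ⟩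
  ∣ kt+r + - + r ∣          ≤⟨ ℤ.∣i+j∣≤∣i∣+∣j∣ kt+r (- + r) ⟩
  ∣ kt+r ∣ ℕ.+ ∣ - + r ∣    ≡⟨ cong (∣ kt+r ∣ ℕ.+_) (ℤ.∣-i∣≡∣i∣ (+ r)) ⟩
  ∣ kt+r ∣ ℕ.+ r            ∎)
  where
  open ℕ.≤-Reasoning
  kt+r = + suc k * t + + r
  k≤k∣t∣ : k ℕ.≤ k ℕ.* ∣ t ∣
  k≤k∣t∣ = ℕ.m≤m*n k ∣ t ∣ {{ℕ.>-nonZero 0<∣t∣}}
  cancel : ∀ x y → x + y + - y ≡ x
  cancel = solve-∀

VanishesBeyond-residue : ∀ {W f k r} → r ℕ.< k → VanishesBeyond W f → VanishesBeyond W (λ t → f (+ k * t + + r))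
VanishesBeyond-residue r<k vanish t W<∣t∣ =
  vanish _ (ℕ.<-≤-trans W<∣t∣ (∣t∣≤∣kt+r∣ t r<k (ℕ.≤-<-trans z≤n W<∣t∣)))

∑ℤ-residues : ∀ {W f} → VanishesBeyond W f → ∀ k →
  ∑ℤ W f ≡ ∑< (suc k) (λ r → ∑ℤ W (λ t → f (+ suc k * t + + r)))
∑ℤ-residues {W} {f} vanish k = begin
  ∑ℤ W f
    ≡⟨ sym (∑<-around-∑ℤ vanish (k ℕ.* W) (k ℕ.* suc W)) ⟩
  ∑< (k ℕ.* W ℕ.+ suc (W ℕ.+ W) ℕ.+ k ℕ.* suc W) g
    ≡⟨ cong (λ L → ∑< L g) (length k W) ⟩
  ∑< (suc (W ℕ.+ W) ℕ.* suc k) g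
    ≡⟨ ∑<-blocks (suc (W ℕ.+ W)) (suc k) g ⟩
  ∑< (suc (W ℕ.+ W)) (λ i → ∑< (suc k) (λ r → g (i ℕ.* suc k ℕ.+ r)))
    ≡⟨ ∑<-cong (suc (W ℕ.+ W)) (λ i _ → ∑<-cong (suc k) (λ r _ → cong f (index i r))) ⟩
  ∑< (suc (W ℕ.+ W)) (λ i → ∑< (suc k) (λ r → f (+ suc k * (+ i - + W) + + r)))
    ≡⟨ sym (∑ℤ-asRange W _) ⟩
  ∑ℤ W (λ t → ∑< (suc k) (λ r → f (+ suc k * t + + r)))
    ≡⟨ sym (∑<-∑ℤ (suc k) W (λ r t → f (+ suc k * t + + r))) ⟩
  ∑< (suc k) (λ r → ∑ℤ W (λ t → f (+ suc k * t + + r))) ∎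
  where
  open ≡-Reasoning
  g = λ j → f (+ j - + (k ℕ.* W ℕ.+ W))
  length : ∀ k w → k ℕ.* w ℕ.+ suc (w ℕ.+ w) ℕ.+ k ℕ.* suc w ≡ suc (w ℕ.+ w) ℕ.* suc k
  length = ℕ-Solver.solve-∀
  blocks : ∀ i k w r → i * (+ 1 + k) + r - (k * w + w) ≡ (+ 1 + k) * (i - w) + r
  blocks = solve-∀
  index : ∀ i r → + (i ℕ.* suc k ℕ.+ r) - + (k ℕ.* W ℕ.+ W) ≡ + suc k * (+ i - + W) + + r
  index i r = trans (cong₂ (λ x y → x + + r - (y + + W)) (ℤ.pos-* i (suc k)) (ℤ.pos-* k W))
    (blocks (+ i) (+ k) (+ W) (+ r))

-- Sums over ℤ² and lattice changes of variables

∑∑ : ℕ → (ℤ → ℤ → ℤ) → ℤ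
∑∑ W g = ∑ℤ W (λ m → ∑ℤ W (λ n → g n m))

∑ℤ*∑ℤ : ∀ W (f g : ℤ → ℤ) → ∑ℤ W f * ∑ℤ W g ≡ ∑∑ W (λ n m → f n * g m)
∑ℤ*∑ℤ W f g = trans (sym (∑ℤ-*ˡ W (∑ℤ W f) g)) (∑ℤ-cong W (λ m → sym (∑ℤ-*ʳ W (g m) f)))

-- Support in a box, rather than mere finiteness of the inner sums, is what makes the swap valid.
HasSum₂ : ℕ → (ℤ → ℤ → ℤ) → ℤ → Set
HasSum₂ W g s = (∀ m → VanishesBeyond W (λ n → g n m)) × (∀ n → VanishesBeyond W (g n)) × ∑∑ W g ≡ s

HasSum₂-cong : ∀ {W g g′ s} → (∀ n m → g n m ≡ g′ n m) → HasSum₂ W g s → HasSum₂ W g′ s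
HasSum₂-cong {W} g≗g′ (vanishˡ , vanishʳ , sum) =
  (λ m n lt → trans (sym (g≗g′ n m)) (vanishˡ m n lt)) ,
  (λ n m lt → trans (sym (g≗g′ n m)) (vanishʳ n m lt)) ,
  trans (sym (∑ℤ-cong W (λ m → ∑ℤ-cong W (λ n → g≗g′ n m)))) sum

HasSum₂-inner : ∀ {W W′ g g′ s} → W ℕ.≤ W′ → (∀ n → VanishesBeyond W′ (g′ n)) →
  (∀ m → HasSum W′ (λ n → g′ n m) (∑ℤ W (λ n → g n m))) → HasSum₂ W g s → HasSum₂ W′ g′ s
HasSum₂-inner {W} {W′} {g} W≤W′ vanishʳ′ inner (_ , vanishʳ , sum) =
  (λ m → proj₁ (inner m)) , vanishʳ′ ,
  trans (∑ℤ-cong W′ (λ m → proj₂ (inner m))) (trans (∑ℤ-grow inner-sums-vanish W≤W′) sum)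
  where
  inner-sums-vanish : VanishesBeyond W (λ m → ∑ℤ W (λ n → g n m))
  inner-sums-vanish m lt = ∑ℤ-zero W (λ n → vanishʳ n m lt)

HasSum₂-mono : ∀ {W W′ g s} → W ℕ.≤ W′ → HasSum₂ W g s → HasSum₂ W′ g s
HasSum₂-mono W≤W′ h@(vanishˡ , vanishʳ , _) = HasSum₂-inner W≤W′
  (λ n → VanishesBeyond-mono W≤W′ (vanishʳ n))
  (λ m → HasSum-mono W≤W′ (vanishˡ m , refl)) h

HasSum₂-unique : ∀ {W W′ g s s′} → HasSum₂ W g s → HasSum₂ W′ g s′ → s ≡ s′
HasSum₂-unique {W} {W′} h h′ =
  trans (sym (proj₂ (proj₂ (HasSum₂-mono (ℕ.m≤m⊔n W W′) h))))
        (proj₂ (proj₂ (HasSum₂-mono (ℕ.m≤n⊔m W W′) h′)))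

HasSum₂-swap : ∀ {W g s} → HasSum₂ W g s → HasSum₂ W (λ n m → g m n) s
HasSum₂-swap {W} {g} (vanishˡ , vanishʳ , sum) = vanishʳ , vanishˡ , trans (sym (∑ℤ-comm W W g)) sum

HasSum₂-negˡ : ∀ {W g s} → HasSum₂ W g s → HasSum₂ W (λ n m → g (- n) m) s
HasSum₂-negˡ h@(vanishˡ , vanishʳ , _) =
  HasSum₂-inner ℕ.≤-refl (λ n → vanishʳ (- n)) (λ m → HasSum-neg (vanishˡ m , refl)) h

HasSum₂-shearˡ : ∀ {W g s} (c : ℤ → ℤ) K → (∀ m → ∣ c m ∣ ℕ.≤ ∣ m ∣ ℕ.+ K) →
  HasSum₂ W g s → HasSum₂ (W ℕ.+ K ℕ.+ W) (λ n m → g (n + c m) m) s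
HasSum₂-shearˡ {W} {g} c K c-bound h@(vanishˡ , vanishʳ , _) =
  HasSum₂-inner W≤W′ (λ n m lt → vanishʳ (n + c m) m (ℕ.≤-<-trans W≤W′ lt)) inner h
  where
  W≤W′ : W ℕ.≤ W ℕ.+ K ℕ.+ W
  W≤W′ = ℕ.m≤n+m W (W ℕ.+ K)
  inner : ∀ m → HasSum (W ℕ.+ K ℕ.+ W) (λ n → g (n + c m) m) (∑ℤ W (λ n → g n m))
  inner m with ∣ m ∣ ℕ.≤? W
  ... | yes ∣m∣≤W = HasSum-mono (ℕ.+-monoˡ-≤ W (ℕ.≤-trans (c-bound m) (ℕ.+-monoˡ-≤ K ∣m∣≤W)))
                                (HasSum-shift (c m) (vanishˡ m , refl))
  ... | no ∣m∣≰W = (λ n _ → zero-column (n + c m)) ,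
                   trans (∑ℤ-zero (W ℕ.+ K ℕ.+ W) (λ n → zero-column (n + c m))) (sym (∑ℤ-zero W zero-column))
    where
    zero-column : ∀ n → g n m ≡ + 0
    zero-column n = vanishʳ n m (ℕ.≰⇒> ∣m∣≰W)

HasSum₂-residue : ∀ {W g s k r} → r ℕ.< k → HasSum₂ W g s →
  HasSum₂ W (λ t m → g (+ k * t + + r) m) (∑∑ W (λ t m → g (+ k * t + + r) m))
HasSum₂-residue r<k (vanishˡ , vanishʳ , _) =
  (λ m → VanishesBeyond-residue r<k (vanishˡ m)) , (λ t → vanishʳ _) , refl

∑∑-residues : ∀ {W g s} → HasSum₂ W g s → ∀ k →
  s ≡ ∑< (suc k) (λ r → ∑∑ W (λ t m → g (+ suc k * t + + r) m))
∑∑-residues {W} {g} (vanishˡ , _ , sum) k =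
  trans (sym sum) (trans (∑ℤ-cong W (λ m → ∑ℤ-residues (vanishˡ m) k))
    (sym (∑<-∑ℤ (suc k) W (λ r m → ∑ℤ W (λ t → g (+ suc k * t + + r) m)))))

pairExp : ℕ → ℕ → ℕ → ℕ → ℤ → ℤ → ℤ
pairExp a k a′ k′ n m = twiceExp a k n + twiceExp a′ k′ m

-- twiceExp as a ring-solver expression: the reflective solver cannot unfold twiceExp.
twiceExpᴱ : ∀ {v} → ℕ → ℕ → Expr ℤ v → Expr ℤ v
twiceExpᴱ a k x = Κ (+ k) ⊗ x ⊗ (x ⊕ ⊝ Κ (+ 1)) ⊕ Κ (+ 2) ⊗ Κ (+ a) ⊗ x

pairExpᴱ : ∀ {v} → ℕ → ℕ → ℕ → ℕ → Expr ℤ v → Expr ℤ v → Expr ℤ v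
pairExpᴱ a k a′ k′ x y = twiceExpᴱ a k x ⊕ twiceExpᴱ a′ k′ y

Q₀ Q₁ Q₂ : ℤ → ℤ → ℤ
Q₀ = pairExp 0 1 0 2
Q₁ = pairExp 1 6 1 3
Q₂ = pairExp 3 6 3 12

∣-t∣≤∣t∣+0 : ∀ t → ∣ - t ∣ ℕ.≤ ∣ t ∣ ℕ.+ 0
∣-t∣≤∣t∣+0 t = ℕ.≤-trans (ℕ.≤-reflexive (ℤ.∣-i∣≡∣i∣ t)) (ℕ.m≤m+n ∣ t ∣ 0)

∣1-t∣≤∣t∣+1 : ∀ t → ∣ + 1 - t ∣ ℕ.≤ ∣ t ∣ ℕ.+ 1
∣1-t∣≤∣t∣+1 t = ℕ.≤-trans (ℤ.∣i+j∣≤∣i∣+∣j∣ (+ 1) (- t))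
  (ℕ.≤-reflexive (trans (cong suc (ℤ.∣-i∣≡∣i∣ t)) (ℕ.+-comm 1 ∣ t ∣)))

Q₀-residue₀≡Q₁ : ∀ (φ : ℤ → ℤ) {W W₁ s s₁} →
  HasSum₂ W (λ t m → φ (Q₀ (+ 3 * t + + 0 + (m - + 1)) m)) s →
  HasSum₂ W₁ (λ n m → φ (Q₁ n m)) s₁ → s ≡ s₁
Q₀-residue₀≡Q₁ φ h h₁ = HasSum₂-unique (HasSum₂-cong (λ t a → cong φ (Q₀→Q₁ t a))
  (HasSum₂-swap (HasSum₂-negˡ
    (HasSum₂-shearˡ (λ t → + 1 - t) 1 ∣1-t∣≤∣t∣+1 (HasSum₂-swap h))))) h₁
  where
  Q₀→Q₁ : ∀ t a → Q₀ (+ 3 * t + + 0 + (- a + (+ 1 - t) - + 1)) (- a + (+ 1 - t)) ≡ Q₁ t a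
  Q₀→Q₁ = solve 2 (λ t a →
    pairExpᴱ 0 1 0 2 (Κ (+ 3) ⊗ t ⊕ Κ (+ 0) ⊕ (⊝ a ⊕ (Κ (+ 1) ⊕ ⊝ t) ⊕ ⊝ Κ (+ 1)))
                     (⊝ a ⊕ (Κ (+ 1) ⊕ ⊝ t))
      ⊜ pairExpᴱ 1 6 1 3 t a) refl

Q₀-residue₂≡Q₁ : ∀ (φ : ℤ → ℤ) {W W₁ s s₁} →
  HasSum₂ W (λ t m → φ (Q₀ (+ 3 * t + + 2 + (m - + 1)) m)) s →
  HasSum₂ W₁ (λ n m → φ (Q₁ n m)) s₁ → s ≡ s₁
Q₀-residue₂≡Q₁ φ h h₁ = HasSum₂-unique (HasSum₂-cong (λ t a → cong φ (Q₀→Q₁ t a))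
  (HasSum₂-negˡ (HasSum₂-swap (HasSum₂-shearˡ (λ t → - t) 0 ∣-t∣≤∣t∣+0 (HasSum₂-swap h))))) h₁
  where
  Q₀→Q₁ : ∀ t a → Q₀ (+ 3 * - t + + 2 + (a + - - t - + 1)) (a + - - t) ≡ Q₁ t a
  Q₀→Q₁ = solve 2 (λ t a →
    pairExpᴱ 0 1 0 2 (Κ (+ 3) ⊗ ⊝ t ⊕ Κ (+ 2) ⊕ (a ⊕ ⊝ ⊝ t ⊕ ⊝ Κ (+ 1))) (a ⊕ ⊝ ⊝ t)
      ⊜ pairExpᴱ 1 6 1 3 t a) refl

Q₀-residue₁≡2Q₂ : ∀ (φ : ℤ → ℤ) {W W₂ s s₂} →
  HasSum₂ W (λ t m → φ (Q₀ (+ 3 * t + + 1 + (m - + 1)) m)) s →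
  HasSum₂ W₂ (λ n m → φ (Q₂ n m)) s₂ → s ≡ s₂ + (s₂ + + 0)
Q₀-residue₁≡2Q₂ φ {W} {s = s} {s₂} h h₂ =
  trans (∑∑-residues sheared 1) (cong₂ (λ x y → x + (y + + 0)) even odd)
  where
  g : ℤ → ℤ → ℤ
  g b t = φ (Q₀ (+ 3 * t + + 1 + (b + - t - + 1)) (b + - t))
  sheared : HasSum₂ (W ℕ.+ 0 ℕ.+ W) g s
  sheared = HasSum₂-shearˡ (λ t → - t) 0 ∣-t∣≤∣t∣+0 (HasSum₂-swap h)
  Q₀→Q₂-even : ∀ t r → Q₀ (+ 3 * t + + 1 + (+ 2 * r + + 0 + - t - + 1)) (+ 2 * r + + 0 + - t) ≡ Q₂ t r
  Q₀→Q₂-even = solve 2 (λ t r →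
    pairExpᴱ 0 1 0 2 (Κ (+ 3) ⊗ t ⊕ Κ (+ 1) ⊕ (Κ (+ 2) ⊗ r ⊕ Κ (+ 0) ⊕ ⊝ t ⊕ ⊝ Κ (+ 1)))
                     (Κ (+ 2) ⊗ r ⊕ Κ (+ 0) ⊕ ⊝ t)
      ⊜ pairExpᴱ 3 6 3 12 t r) refl
  Q₀→Q₂-odd : ∀ t r → Q₀ (+ 3 * t + + 1 + (+ 2 * - r + + 1 + - t - + 1)) (+ 2 * - r + + 1 + - t) ≡ Q₂ t r
  Q₀→Q₂-odd = solve 2 (λ t r →
    pairExpᴱ 0 1 0 2 (Κ (+ 3) ⊗ t ⊕ Κ (+ 1) ⊕ (Κ (+ 2) ⊗ ⊝ r ⊕ Κ (+ 1) ⊕ ⊝ t ⊕ ⊝ Κ (+ 1)))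
                     (Κ (+ 2) ⊗ ⊝ r ⊕ Κ (+ 1) ⊕ ⊝ t)
      ⊜ pairExpᴱ 3 6 3 12 t r) refl
  even : ∑∑ (W ℕ.+ 0 ℕ.+ W) (λ r t → g (+ 2 * r + + 0) t) ≡ s₂
  even = HasSum₂-unique (HasSum₂-cong (λ t r → cong φ (Q₀→Q₂-even t r))
    (HasSum₂-swap (HasSum₂-residue {k = 2} (s≤s z≤n) sheared))) h₂
  odd : ∑∑ (W ℕ.+ 0 ℕ.+ W) (λ r t → g (+ 2 * r + + 1) t) ≡ s₂
  odd = HasSum₂-unique (HasSum₂-cong (λ t r → cong φ (Q₀→Q₂-odd t r))
    (HasSum₂-swap (HasSum₂-negˡ (HasSum₂-residue {k = 2} (s≤s (s≤s z≤n)) sheared)))) h₂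

Q₀-sum≡2Q₁-sum+2Q₂-sum : ∀ (φ : ℤ → ℤ) {W₀ W₁ W₂ s₀ s₁ s₂} →
  HasSum₂ W₀ (λ n m → φ (Q₀ n m)) s₀ → HasSum₂ W₁ (λ n m → φ (Q₁ n m)) s₁ →
  HasSum₂ W₂ (λ n m → φ (Q₂ n m)) s₂ → s₀ ≡ + 2 * s₁ + + 2 * s₂
Q₀-sum≡2Q₁-sum+2Q₂-sum φ {W₀} {s₀ = s₀} {s₁} {s₂} h₀ h₁ h₂ = begin
  s₀                                           ≡⟨ ∑∑-residues sheared 2 ⟩
  class 0 + (class 1 + (class 2 + + 0))        ≡⟨ cong₂ (λ x y → x + (y + (class 2 + + 0)))
                                                    (Q₀-residue₀≡Q₁ φ (residue 0 (s≤s z≤n)) h₁)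
                                                    (Q₀-residue₁≡2Q₂ φ (residue 1 (s≤s (s≤s z≤n))) h₂) ⟩
  s₁ + ((s₂ + (s₂ + + 0)) + (class 2 + + 0))   ≡⟨ cong (λ x → s₁ + ((s₂ + (s₂ + + 0)) + (x + + 0)))
                                                    (Q₀-residue₂≡Q₁ φ (residue 2 (s≤s (s≤s (s≤s z≤n)))) h₁) ⟩
  s₁ + ((s₂ + (s₂ + + 0)) + (s₁ + + 0))        ≡⟨ collect s₁ s₂ ⟩
  + 2 * s₁ + + 2 * s₂                           ∎
  where
  open ≡-Reasoning
  collect : ∀ x y → x + ((y + (y + + 0)) + (x + + 0)) ≡ + 2 * x + + 2 * y
  collect = solve-∀
  W = W₀ ℕ.+ 1 ℕ.+ W₀
  sheared : HasSum₂ W (λ u m → φ (Q₀ (u + (m - + 1)) m)) s₀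
  sheared = HasSum₂-shearˡ (λ m → m - + 1) 1 (λ m → ℤ.∣i+j∣≤∣i∣+∣j∣ m (- + 1)) h₀
  class : ℕ → ℤ
  class r = ∑∑ W (λ t m → φ (Q₀ (+ 3 * t + + r + (m - + 1)) m))
  residue : ∀ r → r ℕ.< 3 → HasSum₂ W (λ t m → φ (Q₀ (+ 3 * t + + r + (m - + 1)) m)) (class r)
  residue r r<3 = HasSum₂-residue r<3 sheared

-- Coefficients of products of theta functions

-- For a ≤ k = a + d the exponent k C(n, 2) + a n of J̄_{a,k} is a natural number;
-- at n = -(p + 1) it is k C(p + 1, 2) + d (p + 1).
exponent : ℕ → ℕ → ℤ → ℕ
exponent a d (+ p)    = (a ℕ.+ d) ℕ.* (p C 2) ℕ.+ a ℕ.* p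
exponent a d -[1+ p ] = (a ℕ.+ d) ℕ.* (suc p C 2) ℕ.+ d ℕ.* suc p

[1+p]C2≡p+pC2 : ∀ p → suc p C 2 ≡ p ℕ.+ p C 2
[1+p]C2≡p+pC2 p = trans (sym (nCk+nC[k+1]≡[n+1]C[k+1] p 1)) (cong (ℕ._+ p C 2) (nC1≡n p))

p[p-1]≡2*pC2 : ∀ p → + p * (+ p - + 1) ≡ + 2 * + (p C 2)
p[p-1]≡2*pC2 zero    = refl
p[p-1]≡2*pC2 (suc p) = begin
  + suc p * (+ suc p - + 1)      ≡⟨ step (+ p) ⟩
  + p * (+ p - + 1) + + 2 * + p  ≡⟨ cong (λ x → x + + 2 * + p) (p[p-1]≡2*pC2 p) ⟩
  + 2 * + (p C 2) + + 2 * + p    ≡⟨ factor (+ (p C 2)) (+ p) ⟩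
  + 2 * (+ p + + (p C 2))        ≡⟨ cong (λ x → + 2 * + x) (sym ([1+p]C2≡p+pC2 p)) ⟩
  + 2 * + (suc p C 2)            ∎
  where
  open ≡-Reasoning
  step : ∀ x → (+ 1 + x) * (+ 1 + x - + 1) ≡ x * (x - + 1) + + 2 * x
  step = solve-∀
  factor : ∀ c x → + 2 * c + + 2 * x ≡ + 2 * (x + c)
  factor = solve-∀

pos-k*c+a*p : ∀ k c a p → + (k ℕ.* c ℕ.+ a ℕ.* p) ≡ + k * + c + + a * + p
pos-k*c+a*p k c a p = trans (ℤ.pos-+ (k ℕ.* c) (a ℕ.* p)) (cong₂ _+_ (ℤ.pos-* k c) (ℤ.pos-* a p))

twiceExp≡2*exponent : ∀ a d n → twiceExp a (a ℕ.+ d) n ≡ + 2 * + exponent a d n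
twiceExp≡2*exponent a d (+ p) = begin
  + k * + p * (+ p - + 1) + + 2 * + a * + p    ≡⟨ reassoc (+ k) (+ a) (+ p) ⟩
  + k * (+ p * (+ p - + 1)) + + 2 * + a * + p  ≡⟨ cong (λ x → + k * x + + 2 * + a * + p) (p[p-1]≡2*pC2 p) ⟩
  + k * (+ 2 * + (p C 2)) + + 2 * + a * + p    ≡⟨ factor (+ k) (+ a) (+ p) (+ (p C 2)) ⟩
  + 2 * (+ k * + (p C 2) + + a * + p)          ≡⟨ cong (+ 2 *_) (sym (pos-k*c+a*p k (p C 2) a p)) ⟩
  + 2 * + exponent a d (+ p)                    ∎
  where
  open ≡-Reasoning
  k = a ℕ.+ d
  reassoc : ∀ k a p → k * p * (p - + 1) + + 2 * a * p ≡ k * (p * (p - + 1)) + + 2 * a * p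
  reassoc = solve-∀
  factor : ∀ k a p c → k * (+ 2 * c) + + 2 * a * p ≡ + 2 * (k * c + a * p)
  factor = solve-∀
twiceExp≡2*exponent a d -[1+ p ] = begin
  (+ a + + d) * - (+ 1 + + p) * (- (+ 1 + + p) - + 1) + + 2 * + a * - (+ 1 + + p)
    ≡⟨ reflect (+ a) (+ d) (+ p) ⟩
  (+ a + + d) * ((+ 1 + + p) * (+ 1 + + p - + 1)) + + 2 * + d * (+ 1 + + p)
    ≡⟨ cong (λ x → (+ a + + d) * x + + 2 * + d * (+ 1 + + p)) (p[p-1]≡2*pC2 (suc p)) ⟩
  (+ a + + d) * (+ 2 * + (suc p C 2)) + + 2 * + d * (+ 1 + + p)
    ≡⟨ factor (+ a + + d) (+ d) (+ p) (+ (suc p C 2)) ⟩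
  + 2 * ((+ a + + d) * + (suc p C 2) + + d * (+ 1 + + p))
    ≡⟨ cong (+ 2 *_) (sym (pos-k*c+a*p (a ℕ.+ d) (suc p C 2) d (suc p))) ⟩
  + 2 * + exponent a d -[1+ p ] ∎
  where
  open ≡-Reasoning
  reflect : ∀ a d p → (a + d) * - (+ 1 + p) * (- (+ 1 + p) - + 1) + + 2 * a * - (+ 1 + p)
                    ≡ (a + d) * ((+ 1 + p) * (+ 1 + p - + 1)) + + 2 * d * (+ 1 + p)
  reflect = solve-∀
  factor : ∀ k d p c → k * (+ 2 * c) + + 2 * d * (+ 1 + p) ≡ + 2 * (k * c + d * (+ 1 + p))
  factor = solve-∀

exponent-beyond : ∀ a d → 1 ℕ.≤ a ℕ.+ d → ∀ {i} n → suc i ℕ.< ∣ n ∣ → i ℕ.< exponent a d n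
exponent-beyond a d 1≤k {i} n lt = ℕ.s≤s⁻¹ (ℕ.<-≤-trans lt (∣n∣≤1+exponent n))
  where
  q≤k*C2 : ∀ q x → q ℕ.≤ (a ℕ.+ d) ℕ.* (suc q C 2) ℕ.+ x
  q≤k*C2 q x = ℕ.≤-trans (ℕ.≤-trans (ℕ.m≤m+n q (q C 2)) (ℕ.≤-reflexive (sym ([1+p]C2≡p+pC2 q))))
    (ℕ.≤-trans (ℕ.m≤n*m (suc q C 2) (a ℕ.+ d) {{ℕ.>-nonZero 1≤k}}) (ℕ.m≤m+n _ x))
  ∣n∣≤1+exponent : ∀ n → ∣ n ∣ ℕ.≤ suc (exponent a d n)
  ∣n∣≤1+exponent (+ zero)  = z≤n
  ∣n∣≤1+exponent (+ suc q) = s≤s (q≤k*C2 q (a ℕ.* suc q))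
  ∣n∣≤1+exponent -[1+ p ]  = s≤s (q≤k*C2 p (d ℕ.* suc p))

2*-⇔ : ∀ {z} x {y} → z ≡ + 2 * + x → (z ≡ + 2 * + y) ⇔ (x ≡ y)
2*-⇔ {z} x {y} z≡2x = mk⇔
  (λ z≡2y → ℤ.+-injective (ℤ.*-cancelˡ-≡ (+ 2) (+ x) (+ y) (trans (sym z≡2x) z≡2y)))
  (λ x≡y → trans z≡2x (cong (λ v → + 2 * + v) x≡y))

𝟙 : ∀ {A : Set} → Dec A → ℤ
𝟙 a? = if does a? then + 1 else + 0

𝟙-⇔ : ∀ {A B : Set} → A ⇔ B → (a? : Dec A) (b? : Dec B) → 𝟙 a? ≡ 𝟙 b?
𝟙-⇔ A⇔B a? b? = cong (if_then + 1 else + 0) (does-⇔ A⇔B a? b?)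

𝟙-no : ∀ {A : Set} → ¬ A → (a? : Dec A) → 𝟙 a? ≡ + 0
𝟙-no ¬a a? = cong (if_then + 1 else + 0) (dec-false a? ¬a)

∑<-𝟙-pick : ∀ L x (h : ℕ → ℤ) → x ℕ.< L → ∑< L (λ i → 𝟙 (x ℕ.≟ i) * h i) ≡ h x
∑<-𝟙-pick (suc L) zero    h _ =
  trans (cong₂ _+_ (ℤ.*-identityˡ (h 0)) (∑<-zero L (λ _ _ → refl))) (ℤ.+-identityʳ (h 0))
∑<-𝟙-pick (suc L) (suc x) h (s≤s x<L) = trans (ℤ.+-identityˡ _) (∑<-𝟙-pick L x (h ∘ suc) x<L)

∑<-𝟙-none : ∀ L x (h : ℕ → ℤ) → L ℕ.≤ x → ∑< L (λ i → 𝟙 (x ℕ.≟ i) * h i) ≡ + 0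
∑<-𝟙-none zero    x       h _         = refl
∑<-𝟙-none (suc L) (suc x) h (s≤s L≤x) = trans (ℤ.+-identityˡ _) (∑<-𝟙-none L x (h ∘ suc) L≤x)

∑<-𝟙-convolve : ∀ N x y → ∑< (suc N) (λ i → 𝟙 (x ℕ.≟ i) * 𝟙 (y ℕ.≟ N ℕ.∸ i)) ≡ 𝟙 (x ℕ.+ y ℕ.≟ N)
∑<-𝟙-convolve N x y with x ℕ.≤? N
... | yes x≤N = trans (∑<-𝟙-pick (suc N) x (λ i → 𝟙 (y ℕ.≟ N ℕ.∸ i)) (s≤s x≤N))
  (𝟙-⇔ (mk⇔ (λ y≡N-x → trans (cong (x ℕ.+_) y≡N-x) (ℕ.m+[n∸m]≡n x≤N))
             (λ x+y≡N → trans (sym (ℕ.m+n∸m≡n x y)) (cong (ℕ._∸ x) x+y≡N)))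
       (y ℕ.≟ N ℕ.∸ x) (x ℕ.+ y ℕ.≟ N))
... | no x≰N = trans (∑<-𝟙-none (suc N) x (λ i → 𝟙 (y ℕ.≟ N ℕ.∸ i)) (ℕ.≰⇒> x≰N))
  (sym (𝟙-no (ℕ.>⇒≢ (ℕ.<-≤-trans (ℕ.≰⇒> x≰N) (ℕ.m≤m+n x y))) (x ℕ.+ y ℕ.≟ N)))

ℤsum-applyUpTo : ∀ L (f : ℕ → ℕ) (h : ℕ → ℤ) → ℤsum (map h (applyUpTo f L)) ≡ ∑< L (h ∘ f)
ℤsum-applyUpTo zero    f h = refl
ℤsum-applyUpTo (suc L) f h = cong (_+_ (h (f 0))) (ℤsum-applyUpTo L (f ∘ suc) h)

Jbar-∑ℤ : ∀ a d → 1 ℕ.≤ a ℕ.+ d → ∀ {W} i → i ℕ.< W →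
  Jbar a (a ℕ.+ d) i ≡ ∑ℤ W (λ n → 𝟙 (exponent a d n ℕ.≟ i))
Jbar-∑ℤ a d 1≤k {W} i i<W = begin
  Jbar a (a ℕ.+ d) i                           ≡⟨ ℤsum-applyUpTo (suc (suc (2 ℕ.* suc i))) (λ j → j) F ⟩
  ∑< (suc (suc (2 ℕ.* suc i))) F               ≡⟨ cong (λ L → ∑< L F) (length i) ⟩
  ∑< L F                                       ≡⟨ ∑<-cong L (λ j _ → F≡f (+ j - + suc i)) ⟩
  ∑< L (λ j → f (+ j - + suc i))               ≡⟨ ∑<-around-∑ℤ vanish 0 1 ⟩
  ∑ℤ (suc i) f                                 ≡⟨ sym (∑ℤ-grow vanish i<W) ⟩
  ∑ℤ W f                                       ∎
  where
  open ≡-Reasoning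
  L = 0 ℕ.+ suc (suc i ℕ.+ suc i) ℕ.+ 1
  F : ℕ → ℤ
  F j = 𝟙 (twiceExp a (a ℕ.+ d) (+ j - + suc i) ℤ.≟ + 2 * + i)
  f : ℤ → ℤ
  f n = 𝟙 (exponent a d n ℕ.≟ i)
  F≡f : ∀ n → 𝟙 (twiceExp a (a ℕ.+ d) n ℤ.≟ + 2 * + i) ≡ f n
  F≡f n = 𝟙-⇔ (2*-⇔ (exponent a d n) (twiceExp≡2*exponent a d n)) (_ ℤ.≟ _) (exponent a d n ℕ.≟ i)
  length : ∀ i → suc (suc (2 ℕ.* suc i)) ≡ 0 ℕ.+ suc (suc i ℕ.+ suc i) ℕ.+ 1
  length = ℕ-Solver.solve-∀
  vanish : VanishesBeyond (suc i) f
  vanish n lt = 𝟙-no (ℕ.>⇒≢ (exponent-beyond a d 1≤k n lt)) (exponent a d n ℕ.≟ i)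

⊛-∑∑ : ∀ a d a′ d′ → 1 ℕ.≤ a ℕ.+ d → 1 ℕ.≤ a′ ℕ.+ d′ → ∀ N →
  (Jbar a (a ℕ.+ d) ⊛ Jbar a′ (a′ ℕ.+ d′)) N
    ≡ ∑∑ (suc N) (λ n m → 𝟙 (exponent a d n ℕ.+ exponent a′ d′ m ℕ.≟ N))
⊛-∑∑ a d a′ d′ 1≤k 1≤k′ N = begin
  (J₁ ⊛ J₂) N
    ≡⟨ ℤsum-applyUpTo (suc N) (λ i → i) (λ i → J₁ i * J₂ (N ℕ.∸ i)) ⟩
  ∑< (suc N) (λ i → J₁ i * J₂ (N ℕ.∸ i))
    ≡⟨ ∑<-cong (suc N) (λ i i≤N → cong₂ _*_ (Jbar-∑ℤ a d 1≤k i i≤N)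
                                            (Jbar-∑ℤ a′ d′ 1≤k′ (N ℕ.∸ i) (s≤s (ℕ.m∸n≤m N i)))) ⟩
  ∑< (suc N) (λ i → ∑ℤ W (f i) * ∑ℤ W (f′ (N ℕ.∸ i)))
    ≡⟨ ∑<-cong (suc N) (λ i _ → ∑ℤ*∑ℤ W (f i) (f′ (N ℕ.∸ i))) ⟩
  ∑< (suc N) (λ i → ∑∑ W (λ n m → f i n * f′ (N ℕ.∸ i) m))
    ≡⟨ ∑<-∑ℤ (suc N) W (λ i m → ∑ℤ W (λ n → f i n * f′ (N ℕ.∸ i) m)) ⟩
  ∑ℤ W (λ m → ∑< (suc N) (λ i → ∑ℤ W (λ n → f i n * f′ (N ℕ.∸ i) m)))
    ≡⟨ ∑ℤ-cong W (λ m → ∑<-∑ℤ (suc N) W (λ i n → f i n * f′ (N ℕ.∸ i) m)) ⟩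
  ∑ℤ W (λ m → ∑ℤ W (λ n → ∑< (suc N) (λ i → f i n * f′ (N ℕ.∸ i) m)))
    ≡⟨ ∑ℤ-cong W (λ m → ∑ℤ-cong W (λ n → ∑<-𝟙-convolve N (exponent a d n) (exponent a′ d′ m))) ⟩
  ∑∑ W (λ n m → 𝟙 (exponent a d n ℕ.+ exponent a′ d′ m ℕ.≟ N)) ∎
  where
  open ≡-Reasoning
  W = suc N
  J₁ = Jbar a (a ℕ.+ d)
  J₂ = Jbar a′ (a′ ℕ.+ d′)
  f f′ : ℕ → ℤ → ℤ
  f i n = 𝟙 (exponent a d n ℕ.≟ i)
  f′ i m = 𝟙 (exponent a′ d′ m ℕ.≟ i)

⊛-HasSum₂ : ∀ a d a′ d′ → 1 ℕ.≤ a ℕ.+ d → 1 ℕ.≤ a′ ℕ.+ d′ → ∀ N →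
  HasSum₂ (suc N) (λ n m → 𝟙 (pairExp a (a ℕ.+ d) a′ (a′ ℕ.+ d′) n m ℤ.≟ + 2 * + N))
          ((Jbar a (a ℕ.+ d) ⊛ Jbar a′ (a′ ℕ.+ d′)) N)
⊛-HasSum₂ a d a′ d′ 1≤k 1≤k′ N =
  HasSum₂-cong (λ n m → sym (pair≡D n m)) (vanishˡ , vanishʳ , sym (⊛-∑∑ a d a′ d′ 1≤k 1≤k′ N))
  where
  e = exponent a d
  e′ = exponent a′ d′
  D : ℤ → ℤ → ℤ
  D n m = 𝟙 (e n ℕ.+ e′ m ℕ.≟ N)
  pair≡D : ∀ n m → 𝟙 (pairExp a (a ℕ.+ d) a′ (a′ ℕ.+ d′) n m ℤ.≟ + 2 * + N) ≡ D n m
  pair≡D n m = 𝟙-⇔ (2*-⇔ (e n ℕ.+ e′ m) pair≡2*) (_ ℤ.≟ _) (e n ℕ.+ e′ m ℕ.≟ N)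
    where
    pair≡2* : pairExp a (a ℕ.+ d) a′ (a′ ℕ.+ d′) n m ≡ + 2 * + (e n ℕ.+ e′ m)
    pair≡2* = trans (cong₂ _+_ (twiceExp≡2*exponent a d n) (twiceExp≡2*exponent a′ d′ m))
      (sym (trans (cong (+ 2 *_) (ℤ.pos-+ (e n) (e′ m))) (ℤ.*-distribˡ-+ (+ 2) (+ e n) (+ e′ m))))
  vanishˡ : ∀ m → VanishesBeyond (suc N) (λ n → D n m)
  vanishˡ m n lt = 𝟙-no (ℕ.>⇒≢ (ℕ.<-≤-trans (exponent-beyond a d 1≤k n lt) (ℕ.m≤m+n (e n) (e′ m))))
                        (e n ℕ.+ e′ m ℕ.≟ N)
  vanishʳ : ∀ n → VanishesBeyond (suc N) (D n)
  vanishʳ n m lt = 𝟙-no (ℕ.>⇒≢ (ℕ.<-≤-trans (exponent-beyond a′ d′ 1≤k′ m lt) (ℕ.m≤n+m (e′ m) (e n))))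
                        (e n ℕ.+ e′ m ℕ.≟ N)

mainTheorem8 : (N : ℕ) →
    (+ 2) * (Jbar 1 6 ⊛ Jbar 1 3) N + (+ 2) * (Jbar 3 6 ⊛ Jbar 3 12) N
      ≡ (Jbar 0 1 ⊛ Jbar 0 2) N
mainTheorem8 N = sym (Q₀-sum≡2Q₁-sum+2Q₂-sum (λ z → 𝟙 (z ℤ.≟ + 2 * + N))
  (⊛-HasSum₂ 0 1 0 2 (s≤s z≤n) (s≤s z≤n) N)
  (⊛-HasSum₂ 1 5 1 2 (s≤s z≤n) (s≤s z≤n) N)
  (⊛-HasSum₂ 3 3 3 9 (s≤s z≤n) (s≤s z≤n) N))
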